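{- Let $G=(X,Y)$ be a bipartite graph with $|X|=n$. Suppose that for some $y,y'\in Y$ with $\deg(y)+\deg(y')\ge n+2$, $G$ has a path from $y$ to $y'$ containing all vertices of $X$. Then $G$ contains a cycle $C$ with $X\subseteq V(C)$.
   Context: All graphs are finite and simple. -}

module Defs where

open import Data.Nat using (ℕ; _+_; _≥_)
open import Data.Fin using (Fin)
open import Data.Bool using (Bool; T)
open import Data.Sum using (_⊎_; inj₁; inj₂)
open import Data.Empty using (⊥)
open import Data.Maybe using (just)
open import Data.Product using (_×_)
open import Data.List using (List; length; filterᵇ; allFin; last; head; _++_; take)
open import Data.List.Relation.Unary.Linked using (Linked)
open import Data.List.Relation.Unary.Unique.Propositional using (Unique)
open import Data.List.Membership.Propositional using (_∈_)
open import Relation.Binary.PropositionalEquality using (_≡_)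

record BipGraph (n m : ℕ) : Set where
  field
    E : Fin n → Fin m → Bool

module _ {n m : ℕ} (G : BipGraph n m) where
  open BipGraph G

  Vertex : Set
  Vertex = Fin n ⊎ Fin m

  Adj : Vertex → Vertex → Set
  Adj (inj₁ x) (inj₂ y) = T (E x y)
  Adj (inj₂ y) (inj₁ x) = T (E x y)
  Adj (inj₁ _) (inj₁ _) = ⊥
  Adj (inj₂ _) (inj₂ _) = ⊥

  degY : Fin m → ℕ
  degY y = length (filterᵇ (λ x → E x y) (allFin n))

  record Path (u v : Vertex) : Set where
    field
      verts    : List Vertex
      start    : head verts ≡ just u
      end      : last verts ≡ just v
      distinct : Unique verts
      adjacent : Linked Adj verts

  record Cycle : Set where
    field
      verts    : List Vertex
      long     : length verts ≥ 3
      distinct : Unique verts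
      closed   : Linked Adj (verts ++ take 1 verts)

{-# OPTIONS --safe #-}
module Submission where

-- Write the path as y x₁ w₁ x₂ … w₍ₖ₋₁₎ xₖ y′. If some xᵢ ~ y′ and xᵢ₊₁ ~ y, then
-- dropping wᵢ and reversing the segment xᵢ₊₁ … y′ gives the cycle
-- y … xᵢ y′ … xᵢ₊₁ y, which still passes through every vertex of X.
-- Otherwise each of the k − 1 consecutive pairs (xᵢ, xᵢ₊₁) carries at most one
-- of the edges xᵢy′, xᵢ₊₁y, so deg y + deg y′ ≤ (k − 1) + 2 ≤ n + 1.

open import Defs
open import Data.Nat using (ℕ; suc; _+_; _≤_; _≥_; z≤n; s≤s)
open import Data.Nat.Properties
  using (≤-trans; ≤-reflexive; +-comm; +-suc; +-mono-≤; m≤n⇒m≤1+n; m≤n+m; ≤⇒≯; module ≤-Reasoning)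
open import Data.Bool using (Bool; true; false; T)
open import Data.Fin using (Fin)
open import Data.Sum using (_⊎_; inj₁; inj₂)
open import Data.Product using (Σ; _×_; _,_)
open import Data.Maybe using (just)
open import Data.List using (List; []; _∷_; _++_; [_]; length; filterᵇ; allFin; last; reverse; _ʳ++_)
open import Data.List.Properties using (++-assoc; ʳ++-defn; length-++; length-reverse; length-tabulate)
open import Data.List.Relation.Unary.Linked as Linked using (Linked; []; [-]; _∷_)
open import Data.List.Relation.Unary.All as All using ()
open import Data.List.Relation.Unary.AllPairs as AllPairs using (_∷_)
open import Data.List.Relation.Unary.Any using (here; there)
open import Data.List.Relation.Unary.Unique.Propositional using (Unique)
open import Data.List.Relation.Unary.Unique.Propositional.Properties using (allFin⁺; filter⁺)
open import Data.List.Membership.Propositional using (_∈_)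
open import Data.List.Membership.Propositional.Properties using (∈-∃++; ∈-allFin)
open import Data.List.Relation.Binary.Subset.Propositional using (_⊆_)
open import Data.List.Relation.Binary.Subset.Propositional.Properties using (filter⁺′)
open import Data.List.Relation.Binary.Permutation.Propositional
  using (_↭_; refl; prep; swap; ↭-sym; ↭⇒↭ₛ; module PermutationReasoning)
open import Data.List.Relation.Binary.Permutation.Propositional.Properties
  using (++⁺ˡ; shift; ↭-reverse; ↭-length; ∈-resp-↭)
import Data.List.Relation.Binary.Permutation.Setoid.Properties as PermutationSetoid
open import Function using (id; _∘_)
open import Level using (0ℓ)
open import Relation.Binary using (Rel; Symmetric)
open import Relation.Binary.PropositionalEquality
  using (_≡_; refl; sym; cong; subst; setoid; module ≡-Reasoning)
open import Relation.Nullary using (¬_; yes; no; contradiction)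
open import Relation.Nullary.Decidable using (T?; _×-dec_)

module _ {A : Set} where

  Unique-resp-↭ : ∀ {xs ys : List A} → xs ↭ ys → Unique xs → Unique ys
  Unique-resp-↭ = PermutationSetoid.Unique-resp-↭ (setoid A) ∘ ↭⇒↭ₛ

  unique⇒length≤ : ∀ {xs ys : List A} → Unique xs → xs ⊆ ys → length xs ≤ length ys
  unique⇒length≤ {[]} _ _ = z≤n
  unique⇒length≤ {x ∷ xs} (x∉xs ∷ u) xs⊆ys with us , vs , refl ← ∈-∃++ (xs⊆ys (here refl)) =
    subst (suc (length xs) ≤_) (sym (↭-length (shift x us vs))) (s≤s (unique⇒length≤ u xs⊆us++vs))
    where
    xs⊆us++vs : xs ⊆ us ++ vs
    xs⊆us++vs z∈xs with ∈-resp-↭ (shift x us vs) (xs⊆ys (there z∈xs))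
    ... | here z≡x = contradiction (sym z≡x) (All.lookup x∉xs z∈xs)
    ... | there z∈us++vs = z∈us++vs

  last-++-∷ : ∀ (xs : List A) {v vs} → last (xs ++ v ∷ vs) ≡ last (v ∷ vs)
  last-++-∷ []           = refl
  last-++-∷ (_ ∷ [])     = refl
  last-++-∷ (_ ∷ v ∷ xs) = last-++-∷ (v ∷ xs)

  ↭-rotate : ∀ (xs : List A) {x w} ys → xs ++ x ∷ w ∷ ys ↭ w ∷ xs ++ x ∷ reverse ys
  ↭-rotate xs {x} {w} ys = begin
    xs ++ x ∷ w ∷ ys          ↭⟨ ++⁺ˡ xs (swap x w refl) ⟩
    xs ++ w ∷ x ∷ ys          ↭⟨ shift w xs (x ∷ ys) ⟩
    w ∷ xs ++ x ∷ ys          ↭⟨ prep w (++⁺ˡ xs (prep x (↭-sym (↭-reverse ys)))) ⟩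
    w ∷ xs ++ x ∷ reverse ys  ∎
    where open PermutationReasoning

  length-rotate : ∀ {a x z : A} xs ys → 3 ≤ length (a ∷ xs ++ x ∷ reverse (z ∷ ys))
  length-rotate {a} {x} {z} xs ys
    rewrite length-++ xs {x ∷ reverse (z ∷ ys)} | length-reverse (z ∷ ys) =
    s≤s (≤-trans (s≤s (s≤s z≤n)) (m≤n+m (suc (suc (length ys))) (length xs)))

count : {A : Set} → (A → Bool) → List A → ℕ
count p xs = length (filterᵇ p xs)

module _ {n : ℕ} where

  unique⇒length≤n : ∀ {xs : List (Fin n)} → Unique xs → length xs ≤ n
  unique⇒length≤n {xs} u =
    subst (length xs ≤_) (length-tabulate id) (unique⇒length≤ u (λ {i} _ → ∈-allFin i))

  count-allFin≤ : ∀ (p : Fin n → Bool) {xs} → (∀ i → i ∈ xs) → count p (allFin n) ≤ count p xs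
  count-allFin≤ p cover =
    unique⇒length≤ (filter⁺ (T? ∘ p) (allFin⁺ n)) (filter⁺′ (T? ∘ p) (T? ∘ p) id {allFin n} (λ {i} _ → cover i))

module _ {A : Set} (α β : A → Bool) where

  private
    NoPair : Rel A 0ℓ
    NoPair u v = ¬ (T (β u) × T (α v))

  -- α(xᵢ₊₁) is paired with β(xᵢ), so only β of the last element is left over.
  count-paired≤ : ∀ {x xs} → Linked NoPair (x ∷ xs) → count α xs + count β (x ∷ xs) ≤ length (x ∷ xs)
  count-paired≤ {x} [-] with β x
  ... | true  = s≤s z≤n
  ... | false = z≤n
  count-paired≤ {x} {v ∷ vs} (¬βx×αv ∷ l) with β x | α v | count-paired≤ l
  ... | true  | true  | _  = contradiction (_ , _) ¬βx×αv
  ... | true  | false | ih = subst (_≤ suc (length (v ∷ vs))) (sym (+-suc _ _)) (s≤s ih)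
  ... | false | true  | ih = s≤s ih
  ... | false | false | ih = m≤n⇒m≤1+n ih

  count-+-count≤ : ∀ {xs} → Linked NoPair xs → count α xs + count β xs ≤ suc (length xs)
  count-+-count≤ [] = z≤n
  count-+-count≤ {x ∷ _} l with α x
  ... | true  = s≤s (count-paired≤ l)
  ... | false = m≤n⇒m≤1+n (count-paired≤ l)

module _ {A B : Set} where

  lefts : List (A ⊎ B) → List A
  lefts []            = []
  lefts (inj₁ a ∷ xs) = a ∷ lefts xs
  lefts (inj₂ _ ∷ xs) = lefts xs

  ∈-lefts : ∀ {a} {xs : List (A ⊎ B)} → inj₁ a ∈ xs → a ∈ lefts xs
  ∈-lefts {xs = inj₁ _ ∷ _} (here refl) = here refl
  ∈-lefts {xs = inj₁ _ ∷ _} (there a∈)  = there (∈-lefts a∈)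
  ∈-lefts {xs = inj₂ _ ∷ _} (there a∈)  = ∈-lefts a∈

  ∈-lefts⁻ : ∀ {a} (xs : List (A ⊎ B)) → a ∈ lefts xs → inj₁ a ∈ xs
  ∈-lefts⁻ (inj₁ _ ∷ _)  (here refl) = here refl
  ∈-lefts⁻ (inj₁ _ ∷ xs) (there a∈)  = there (∈-lefts⁻ xs a∈)
  ∈-lefts⁻ (inj₂ _ ∷ xs) a∈          = there (∈-lefts⁻ xs a∈)

  Unique-lefts : ∀ {xs : List (A ⊎ B)} → Unique xs → Unique (lefts xs)
  Unique-lefts {[]} _ = AllPairs.[]
  Unique-lefts {inj₁ a ∷ xs} (a∉xs ∷ u) =
    All.tabulate (λ b∈ a≡b → All.lookup a∉xs (∈-lefts⁻ xs b∈) (cong inj₁ a≡b)) ∷ Unique-lefts u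
  Unique-lefts {inj₂ _ ∷ xs} (_ ∷ u) = Unique-lefts u

module _ {V : Set} {R : Rel V 0ℓ} where

  Linked-++⁻ʳ : ∀ xs {ys} → Linked R (xs ++ ys) → Linked R ys
  Linked-++⁻ʳ []       l = l
  Linked-++⁻ʳ (_ ∷ xs) l = Linked-++⁻ʳ xs (Linked.tail l)

  Linked-replace-suffix : ∀ xs {z ys zs} → Linked R (xs ++ z ∷ ys) → Linked R (z ∷ zs) → Linked R (xs ++ z ∷ zs)
  Linked-replace-suffix []            _        l = l
  Linked-replace-suffix (_ ∷ [])      (r ∷ _)  l = r ∷ l
  Linked-replace-suffix (_ ∷ x ∷ xs)  (r ∷ l′) l = r ∷ Linked-replace-suffix (x ∷ xs) l′ l

  module _ (R-sym : Symmetric R) where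

    Linked-∷-ʳ++ : ∀ {u z b} zs {acc} → Linked R (z ∷ zs) → last (z ∷ zs) ≡ just b → R u b →
                   Linked R (z ∷ acc) → Linked R (u ∷ (z ∷ zs) ʳ++ acc)
    Linked-∷-ʳ++ []       _       refl u~b l   = u~b ∷ l
    Linked-∷-ʳ++ (_ ∷ zs) (r ∷ l) end  u~b acc = Linked-∷-ʳ++ zs l end u~b (R-sym r ∷ acc)

    Linked-rotate : ∀ {a x w x′ b} xs ys → Linked R (a ∷ xs ++ x ∷ w ∷ x′ ∷ ys) →
                    last (x′ ∷ ys) ≡ just b → R x b → R x′ a →
                    Linked R ((a ∷ xs ++ x ∷ reverse (x′ ∷ ys)) ++ [ a ])
    Linked-rotate {a} {x} {x′ = x′} xs ys path end x~b x′~a =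
      subst (Linked R) (cong (a ∷_) (sym closing))
        (Linked-replace-suffix (a ∷ xs) path
          (Linked-∷-ʳ++ ys (Linked.tail (Linked.tail (Linked-++⁻ʳ (a ∷ xs) path))) end x~b (x′~a ∷ [-])))
      where
      open ≡-Reasoning
      closing : (xs ++ x ∷ reverse (x′ ∷ ys)) ++ [ a ] ≡ xs ++ x ∷ (x′ ∷ ys) ʳ++ [ a ]
      closing = begin
        (xs ++ x ∷ reverse (x′ ∷ ys)) ++ [ a ]  ≡⟨ ++-assoc xs _ [ a ] ⟩
        xs ++ x ∷ reverse (x′ ∷ ys) ++ [ a ]    ≡⟨ cong (λ t → xs ++ x ∷ t) (sym (ʳ++-defn (x′ ∷ ys))) ⟩
        xs ++ x ∷ (x′ ∷ ys) ʳ++ [ a ]           ∎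

module _ {n m : ℕ} (G : BipGraph n m) (y y′ : Fin m) where
  open BipGraph G

  Adj-sym : Symmetric (Adj G)
  Adj-sym {inj₁ _} {inj₂ _} e = e
  Adj-sym {inj₂ _} {inj₁ _} e = e

  NonCrossing : Rel (Fin n) 0ℓ
  NonCrossing x x′ = ¬ (T (E x y′) × T (E x′ y))

  record Crossing (L : List (Vertex G)) : Set where
    constructor crossing
    field
      front : List (Vertex G)
      x     : Fin n
      w     : Fin m
      x′    : Fin n
      back  : List (Vertex G)
      split : L ≡ front ++ inj₁ x ∷ inj₂ w ∷ inj₁ x′ ∷ back
      x~y′  : T (E x y′)
      x′~y  : T (E x′ y)

  crossing-∷ : ∀ v {L} → Crossing L → Crossing (v ∷ L)
  crossing-∷ v (crossing A x w x′ S refl x~y′ x′~y) = crossing (v ∷ A) x w x′ S refl x~y′ x′~y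

  crossing-or-nonCrossing : ∀ L → Linked (Adj G) L → Crossing L ⊎ Linked NonCrossing (lefts L)
  crossing-or-nonCrossing []                    _ = inj₂ []
  crossing-or-nonCrossing (inj₂ w ∷ [])         _ = inj₂ []
  crossing-or-nonCrossing (inj₂ w ∷ v ∷ L)      (_ ∷ l) with crossing-or-nonCrossing (v ∷ L) l
  ... | inj₁ c  = inj₁ (crossing-∷ (inj₂ w) c)
  ... | inj₂ nc = inj₂ nc
  crossing-or-nonCrossing (inj₁ x ∷ [])                     _ = inj₂ [-]
  crossing-or-nonCrossing (inj₁ x ∷ inj₂ w ∷ [])            _ = inj₂ [-]
  crossing-or-nonCrossing (inj₁ x ∷ inj₁ _ ∷ _)             (() ∷ _)
  crossing-or-nonCrossing (inj₁ x ∷ inj₂ w ∷ inj₂ _ ∷ _)    (_ ∷ () ∷ _)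
  crossing-or-nonCrossing (inj₁ x ∷ inj₂ w ∷ inj₁ x′ ∷ L)   (_ ∷ _ ∷ l)
    with T? (E x y′) ×-dec T? (E x′ y)
  ... | yes (x~y′ , x′~y) = inj₁ (crossing [] x w x′ L refl x~y′ x′~y)
  ... | no ¬crossing with crossing-or-nonCrossing (inj₁ x′ ∷ L) l
  ...   | inj₁ c  = inj₁ (crossing-∷ (inj₁ x) (crossing-∷ (inj₂ w) c))
  ...   | inj₂ nc = inj₂ (¬crossing ∷ nc)

  crossing⇒cycle : ∀ {L} → Linked (Adj G) (inj₂ y ∷ L) → Unique (inj₂ y ∷ L) →
                   last (inj₂ y ∷ L) ≡ just (inj₂ y′) → Crossing L →
                   Σ (Cycle G) (λ C → ∀ x → inj₁ x ∈ inj₂ y ∷ L → inj₁ x ∈ Cycle.verts C)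
  crossing⇒cycle path distinct end (crossing A x w x′ S refl x~y′ x′~y) =
    record { verts = C ; long = length-rotate {a = inj₂ y} {inj₁ x} {inj₁ x′} A S ; distinct = distinct-C
           ; closed = Linked-rotate (λ {u} {v} → Adj-sym {u} {v}) A S path end′ x~y′ x′~y }
    , on-C
    where
    C : List (Vertex G)
    C = inj₂ y ∷ A ++ inj₁ x ∷ reverse (inj₁ x′ ∷ S)

    drop-w : inj₂ y ∷ A ++ inj₁ x ∷ inj₂ w ∷ inj₁ x′ ∷ S ↭ inj₂ w ∷ C
    drop-w = ↭-rotate (inj₂ y ∷ A) (inj₁ x′ ∷ S)

    end′ : last (inj₁ x′ ∷ S) ≡ just (inj₂ y′)
    end′ = subst (_≡ just (inj₂ y′)) (last-++-∷ (inj₂ y ∷ A)) end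

    distinct-C : Unique C
    distinct-C = AllPairs.tail (Unique-resp-↭ drop-w distinct)

    on-C : ∀ z → inj₁ z ∈ inj₂ y ∷ A ++ inj₁ x ∷ inj₂ w ∷ inj₁ x′ ∷ S → inj₁ z ∈ C
    on-C z z∈ with ∈-resp-↭ drop-w z∈
    ... | there z∈C = z∈C

  degree-sum≤ : ∀ {L : List (Vertex G)} → Unique L → (∀ x → inj₁ x ∈ L) → Linked NonCrossing (lefts L) →
                degY G y + degY G y′ ≤ suc n
  degree-sum≤ {L} distinct cover nc = begin
    degY G y + degY G y′                                 ≤⟨ +-mono-≤ (count-allFin≤ _ cover′) (count-allFin≤ _ cover′) ⟩
    count (λ x → E x y) xs + count (λ x → E x y′) xs     ≤⟨ count-+-count≤ (λ x → E x y) (λ x → E x y′) nc ⟩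
    suc (length xs)                                      ≤⟨ s≤s (unique⇒length≤n (Unique-lefts distinct)) ⟩
    suc n                                                ∎
    where
    open ≤-Reasoning
    xs = lefts L
    cover′ : ∀ x → x ∈ xs
    cover′ x = ∈-lefts (cover x)

lemma3p1 : (n m : ℕ) (G : BipGraph n m) (y y′ : Fin m) →
    degY G y + degY G y′ ≥ n + 2 →
    (P : Path G (inj₂ y) (inj₂ y′)) →
    (∀ (x : Fin n) → inj₁ x ∈ Path.verts P) →
    Σ (Cycle G) (λ C → ∀ (x : Fin n) → inj₁ x ∈ Cycle.verts C)
lemma3p1 n m G y y′ deg≥ record { verts = [] ; start = () }
lemma3p1 n m G y y′ deg≥
  record { verts = _ ∷ L ; start = refl ; end = end ; distinct = distinct ; adjacent = path } cover
  with crossing-or-nonCrossing G y y′ L (Linked.tail path)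
... | inj₁ c =
  let C , on-C = crossing⇒cycle G y y′ path distinct end c in C , λ x → on-C x (cover x)
... | inj₂ nc =
  contradiction (≤-trans (≤-reflexive (+-comm 2 n)) deg≥) (≤⇒≯ (degree-sum≤ G y y′ distinct cover nc))
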